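{- Let $K \ge 1$ be a real number and let $\{p_n\}_{n=1}^{\infty}$ be a sequence of positive integers such that $p_{n+1} \ge K p_n (p_n + 1)$ holds for all sufficiently large $n \in \mathbb{N}$. Let $l \in \{1, 2, \dots, [K]\}$, where $[K]$ is the integer part of $K$. Then \[ f(-l; \{p_n\}) = \sum_{n=1}^{\infty} \frac{(-1)^n}{p_n} l^n \] is an irrational number.
   Context: For such a sequence $\{p_n\}$, $f(z;\{p_n\}) = \sum_{n=1}^{\infty} z^n/p_n$ defines an entire function of $z$.
   Formalization: The parameter $K$ ranges over the rationals rather than over the real numbers. -}

module Defs where

open import Data.Nat as ℕ using (ℕ; zero; suc)
open import Data.Integer as ℤ using (ℤ; +_; -[1+_])
open import Data.Rational using (ℚ; 0ℚ; _+_; _*_; _-_; _<_; ∣_∣; _/_; -_)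
open import Data.Product using (∃-syntax)

-- 1 / d as a rational (d = 0 is mapped to 0; only used with d > 0)
inv : ℕ → ℚ
inv zero = 0ℚ
inv (suc k) = (+ 1) / suc k

negPow : ℕ → ℕ → ℚ
negPow l zero = (+ 1) / 1
negPow l (suc n) = (- ((+ l) / 1)) * negPow l n

term : (ℕ → ℕ) → ℕ → ℕ → ℚ
term p l n = negPow l n * inv (p n)

partialSum : (ℕ → ℕ) → ℕ → ℕ → ℚ
partialSum p l zero = 0ℚ
partialSum p l (suc N) = partialSum p l N + term p l (suc N)

ConvergesTo : (ℕ → ℚ) → ℚ → Set
ConvergesTo s q = ∀ (ε : ℚ) → 0ℚ < ε → ∃[ N ] ∀ (M : ℕ) → N ℕ.≤ M → ∣ s M - q ∣ < ε

{-# OPTIONS --safe #-}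
-- Suppose the partial sums Sₙ converge to a rational q with denominator b. The signed remainder
-- rₙ = (-1)ⁿ⁺¹ (q - Sₙ) satisfies rₙ + rₙ₊₁ = lⁿ⁺¹/pₙ₊₁, and these terms eventually decrease,
-- so rₙ > 0 for large n. The growth condition pₙ₊₁ ≥ l pₙ (pₙ + 1) then gives pₙ₊₁ rₙ₊₁ < rₙ.
-- Clearing denominators, aₙ = b p₁ ⋯ pₙ rₙ is an integer, positive and strictly decreasing for
-- large n: an infinite descent.

module Submission where

open import Defs
open import Data.Nat as ℕ using (ℕ; zero; suc)
import Data.Nat.Properties as ℕP
open import Data.Integer as ℤ using (ℤ; +_)
import Data.Integer.Properties as ℤP
import Data.Integer.DivMod as ℤD
open import Data.Rational
open import Data.Rational.Properties
open import Data.Rational.Unnormalised as ℚᵘ using (mkℚᵘ; *≡*; *≤*; *<*)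
import Data.Rational.Unnormalised.Properties as ℚᵘP
open import Data.Product using (∃-syntax; _,_; proj₁; proj₂)
open import Data.Sum using (inj₁; inj₂)
open import Data.Empty using (⊥; ⊥-elim)
open import Induction.InfiniteDescent using (InfiniteDescendingSequence)
open import Relation.Binary.PropositionalEquality
open import Relation.Nullary using (¬_; yes; no)

import Data.Nat.Solver as ℕSolver
import Data.Rational.Solver as ℚSolver

fromℤ : ℤ → ℚ
fromℤ i = i / 1

toℚᵘ-fromℤ : ∀ i → toℚᵘ (fromℤ i) ℚᵘ.≃ mkℚᵘ i 0
toℚᵘ-fromℤ i = toℚᵘ-fromℚᵘ (mkℚᵘ i 0)

module _ where
  open ℚᵘP.≃-Reasoning

  fromℤ-homo-+ : ∀ i j → fromℤ (i ℤ.+ j) ≡ fromℤ i + fromℤ j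
  fromℤ-homo-+ i j = toℚᵘ-injective (begin
    toℚᵘ (fromℤ (i ℤ.+ j))          ≈⟨ toℚᵘ-fromℤ (i ℤ.+ j) ⟩
    mkℚᵘ (i ℤ.+ j) 0                ≈⟨ *≡* (cong (ℤ._* + 1) (sym (cong₂ ℤ._+_ (ℤP.*-identityʳ i) (ℤP.*-identityʳ j)))) ⟩
    mkℚᵘ i 0 ℚᵘ.+ mkℚᵘ j 0          ≈⟨ ℚᵘP.+-cong (toℚᵘ-fromℤ i) (toℚᵘ-fromℤ j) ⟨
    toℚᵘ (fromℤ i) ℚᵘ.+ toℚᵘ (fromℤ j) ≈⟨ toℚᵘ-homo-+ (fromℤ i) (fromℤ j) ⟨
    toℚᵘ (fromℤ i + fromℤ j)        ∎)

  fromℤ-homo-* : ∀ i j → fromℤ (i ℤ.* j) ≡ fromℤ i * fromℤ j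
  fromℤ-homo-* i j = toℚᵘ-injective (begin
    toℚᵘ (fromℤ (i ℤ.* j))          ≈⟨ toℚᵘ-fromℤ (i ℤ.* j) ⟩
    mkℚᵘ (i ℤ.* j) 0                ≈⟨ *≡* refl ⟩
    mkℚᵘ i 0 ℚᵘ.* mkℚᵘ j 0          ≈⟨ ℚᵘP.*-cong (toℚᵘ-fromℤ i) (toℚᵘ-fromℤ j) ⟨
    toℚᵘ (fromℤ i) ℚᵘ.* toℚᵘ (fromℤ j) ≈⟨ toℚᵘ-homo-* (fromℤ i) (fromℤ j) ⟨
    toℚᵘ (fromℤ i * fromℤ j)        ∎)

  fromℤ-homo-neg : ∀ i → fromℤ (ℤ.- i) ≡ - fromℤ i
  fromℤ-homo-neg i = toℚᵘ-injective (begin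
    toℚᵘ (fromℤ (ℤ.- i)) ≈⟨ toℚᵘ-fromℤ (ℤ.- i) ⟩
    mkℚᵘ (ℤ.- i) 0       ≈⟨ ℚᵘP.-‿cong (toℚᵘ-fromℤ i) ⟨
    ℚᵘ.- toℚᵘ (fromℤ i)  ≈⟨ toℚᵘ-homo‿- (fromℤ i) ⟨
    toℚᵘ (- fromℤ i)     ∎)

fromℤ-mono-≤ : ∀ {i j} → i ℤ.≤ j → fromℤ i ≤ fromℤ j
fromℤ-mono-≤ {i} {j} i≤j = toℚᵘ-cancel-≤
  (ℚᵘP.≤-respʳ-≃ (ℚᵘP.≃-sym (toℚᵘ-fromℤ j)) (ℚᵘP.≤-respˡ-≃ (ℚᵘP.≃-sym (toℚᵘ-fromℤ i))
    (*≤* (ℤP.*-monoʳ-≤-nonNeg (+ 1) i≤j))))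

fromℤ-cancel-≤ : ∀ {i j} → fromℤ i ≤ fromℤ j → i ℤ.≤ j
fromℤ-cancel-≤ {i} {j} h
  with ℚᵘP.≤-respʳ-≃ (toℚᵘ-fromℤ j) (ℚᵘP.≤-respˡ-≃ (toℚᵘ-fromℤ i) (toℚᵘ-mono-≤ h))
... | *≤* i≤j = ℤP.*-cancelʳ-≤-pos i j (+ 1) i≤j

fromℤ-mono-< : ∀ {i j} → i ℤ.< j → fromℤ i < fromℤ j
fromℤ-mono-< {i} {j} i<j = toℚᵘ-cancel-<
  (ℚᵘP.<-respʳ-≃ (ℚᵘP.≃-sym (toℚᵘ-fromℤ j)) (ℚᵘP.<-respˡ-≃ (ℚᵘP.≃-sym (toℚᵘ-fromℤ i))
    (*<* (ℤP.*-monoʳ-<-pos (+ 1) i<j))))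

fromℤ-cancel-< : ∀ {i j} → fromℤ i < fromℤ j → i ℤ.< j
fromℤ-cancel-< {i} {j} h
  with ℚᵘP.<-respʳ-≃ (toℚᵘ-fromℤ j) (ℚᵘP.<-respˡ-≃ (toℚᵘ-fromℤ i) (toℚᵘ-mono-< h))
... | *<* i<j = ℤP.*-cancelʳ-<-nonNeg (+ 1) i<j

fromℕ : ℕ → ℚ
fromℕ n = fromℤ (+ n)

fromℕ-homo-+ : ∀ m n → fromℕ (m ℕ.+ n) ≡ fromℕ m + fromℕ n
fromℕ-homo-+ m n = trans (cong fromℤ (ℤP.pos-+ m n)) (fromℤ-homo-+ (+ m) (+ n))

fromℕ-homo-* : ∀ m n → fromℕ (m ℕ.* n) ≡ fromℕ m * fromℕ n
fromℕ-homo-* m n = trans (cong fromℤ (ℤP.pos-* m n)) (fromℤ-homo-* (+ m) (+ n))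

fromℕ-nonNeg : ∀ n → 0ℚ ≤ fromℕ n
fromℕ-nonNeg n = fromℤ-mono-≤ {+ 0} {+ n} (ℤ.+≤+ ℕ.z≤n)

fromℤ-floor-≤ : ∀ K → fromℤ (floor K) ≤ K
fromℤ-floor-≤ K@(mkℚ n d _) = toℚᵘ-cancel-≤ (ℚᵘP.≤-respˡ-≃ (ℚᵘP.≃-sym (toℚᵘ-fromℤ (floor K)))
  (*≤* (subst (floor K ℤ.* + suc d ℤ.≤_) (sym (ℤP.*-identityʳ n)) (ℤD.[n/d]*d≤n n (+ suc d)))))

fromℤ-↥ : ∀ q → fromℤ (↥ q) ≡ fromℕ (↧ₙ q) * q
fromℤ-↥ q@(mkℚ n d _) = toℚᵘ-injective (begin
    toℚᵘ (fromℤ n)                     ≈⟨ toℚᵘ-fromℤ n ⟩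
    mkℚᵘ n 0                           ≈⟨ *≡* n*[1+d]≡[1+d]*n*1 ⟩
    mkℚᵘ (+ suc d) 0 ℚᵘ.* mkℚᵘ n d     ≈⟨ ℚᵘP.*-cong (toℚᵘ-fromℤ (+ suc d)) ℚᵘP.≃-refl ⟨
    toℚᵘ (fromℕ (suc d)) ℚᵘ.* toℚᵘ q   ≈⟨ toℚᵘ-homo-* (fromℕ (suc d)) q ⟨
    toℚᵘ (fromℕ (suc d) * q)           ∎)
  where
    open ℚᵘP.≃-Reasoning
    n*[1+d]≡[1+d]*n*1 : n ℤ.* + suc (d ℕ.+ 0) ≡ (+ suc d ℤ.* n) ℤ.* + 1
    n*[1+d]≡[1+d]*n*1 rewrite ℕP.+-identityʳ d = trans (ℤP.*-comm n (+ suc d)) (sym (ℤP.*-identityʳ _))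

≤floor∧K*m≤n⇒l*m≤n : ∀ K {l} m n → + l ℤ.≤ floor K → K * fromℕ m ≤ fromℕ n → l ℕ.* m ℕ.≤ n
≤floor∧K*m≤n⇒l*m≤n K {l} m n l≤⌊K⌋ K*m≤n = ℤP.drop‿+≤+ (fromℤ-cancel-≤ (begin
  fromℕ (l ℕ.* m)   ≡⟨ fromℕ-homo-* l m ⟩
  fromℕ l * fromℕ m ≤⟨ *-monoʳ-≤-nonNeg (fromℕ m) {{nonNegative (fromℕ-nonNeg m)}}
                         (≤-trans (fromℤ-mono-≤ l≤⌊K⌋) (fromℤ-floor-≤ K)) ⟩
  K * fromℕ m       ≤⟨ K*m≤n ⟩
  fromℕ n           ∎))
  where open ≤-Reasoning

toℚᵘ-fromℕ*inv : ∀ x y → toℚᵘ (fromℕ x * inv (suc y)) ℚᵘ.≃ mkℚᵘ (+ x) y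
toℚᵘ-fromℕ*inv x y = begin
  toℚᵘ (fromℕ x * inv (suc y))           ≈⟨ toℚᵘ-homo-* (fromℕ x) (inv (suc y)) ⟩
  toℚᵘ (fromℕ x) ℚᵘ.* toℚᵘ (inv (suc y)) ≈⟨ ℚᵘP.*-cong (toℚᵘ-fromℤ (+ x)) (toℚᵘ-fromℚᵘ (mkℚᵘ (+ 1) y)) ⟩
  mkℚᵘ (+ x) 0 ℚᵘ.* mkℚᵘ (+ 1) y         ≈⟨ *≡* (cong₂ ℤ._*_ (ℤP.*-identityʳ (+ x)) (cong (λ k → + suc k) (sym (ℕP.+-identityʳ y)))) ⟩
  mkℚᵘ (+ x) y                           ∎
  where open ℚᵘP.≃-Reasoning

fromℕ*inv≡1 : ∀ {k} → 1 ℕ.≤ k → fromℕ k * inv k ≡ 1ℚ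
fromℕ*inv≡1 {suc k} _ = toℚᵘ-injective (ℚᵘP.≃-trans (toℚᵘ-fromℕ*inv (suc k) k)
  (*≡* (trans (ℤP.*-identityʳ (+ suc k)) (sym (ℤP.*-identityˡ (+ suc k))))))

fromℕ*inv-≤ : ∀ x y u v → x ℕ.* suc v ℕ.≤ u ℕ.* suc y →
              fromℕ x * inv (suc y) ≤ fromℕ u * inv (suc v)
fromℕ*inv-≤ x y u v h = toℚᵘ-cancel-≤
  (ℚᵘP.≤-respʳ-≃ (ℚᵘP.≃-sym (toℚᵘ-fromℕ*inv u v)) (ℚᵘP.≤-respˡ-≃ (ℚᵘP.≃-sym (toℚᵘ-fromℕ*inv x y))
    (*≤* (subst₂ ℤ._≤_ (ℤP.pos-* x (suc v)) (ℤP.pos-* u (suc y)) (ℤ.+≤+ h)))))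

fromℕ*inv-< : ∀ x y u v → x ℕ.* suc v ℕ.< u ℕ.* suc y →
              fromℕ x * inv (suc y) < fromℕ u * inv (suc v)
fromℕ*inv-< x y u v h = toℚᵘ-cancel-<
  (ℚᵘP.<-respʳ-≃ (ℚᵘP.≃-sym (toℚᵘ-fromℕ*inv u v)) (ℚᵘP.<-respˡ-≃ (ℚᵘP.≃-sym (toℚᵘ-fromℕ*inv x y))
    (*<* (subst₂ ℤ._<_ (ℤP.pos-* x (suc v)) (ℤP.pos-* u (suc y)) (ℤ.+<+ h)))))

-- Eventually positive sequences and infinite descent

-p≤∣p∣ : ∀ p → - p ≤ ∣ p ∣
-p≤∣p∣ p with ∣p∣≡p∨∣p∣≡-p p
... | inj₁ ∣p∣≡p  = ≤-trans (neg-antimono-≤ (∣p∣≡p⇒0≤p ∣p∣≡p)) (0≤∣p∣ p)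
... | inj₂ ∣p∣≡-p = ≤-reflexive (sym ∣p∣≡-p)

x+[y-z]<x : ∀ x {y z} → y < z → x + (y - z) < x
x+[y-z]<x x {y} {z} y<z = begin-strict
  x + (y - z)  <⟨ +-monoʳ-< x (subst (y - z <_) (+-inverseʳ z) (+-monoˡ-< (- z) y<z)) ⟩
  x + 0ℚ       ≡⟨ +-identityʳ x ⟩
  x            ∎
  where open ≤-Reasoning

x<x+y : ∀ x {y} → 0ℚ < y → x < x + y
x<x+y x {y} 0<y = begin-strict
  x       ≡⟨ +-identityʳ x ⟨
  x + 0ℚ  <⟨ +-monoʳ-< x 0<y ⟩
  x + y   ∎
  where open ≤-Reasoning

summand-scaled-< : ∀ {c x y T T′} → 0ℚ ≤ c → x + y ≡ T → y < T′ → (c + 1ℚ) * T′ ≤ T → c * y < x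
summand-scaled-< {c} {x} {y} {T} {T′} 0≤c x+y≡T y<T′ [c+1]T′≤T = begin-strict
  c * y                 ≡⟨ solve 2 (λ c y → c :* y := (c :+ con 1ℚ) :* y :- y) refl c y ⟩
  (c + 1ℚ) * y - y      <⟨ +-monoˡ-< (- y) (*-monoʳ-<-pos (c + 1ℚ) {{positive 0<c+1}} y<T′) ⟩
  (c + 1ℚ) * T′ - y     ≤⟨ +-monoˡ-≤ (- y) [c+1]T′≤T ⟩
  T - y                 ≡⟨ cong (_- y) (sym x+y≡T) ⟩
  (x + y) - y           ≡⟨ solve 2 (λ x y → (x :+ y) :- y := x) refl x y ⟩
  x                     ∎
  where
    open ≤-Reasoning
    open ℚSolver.+-*-Solver
    0<c+1 : 0ℚ < c + 1ℚ
    0<c+1 = +-mono-≤-< 0≤c (positive⁻¹ 1ℚ)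

x[2k+n]≤x[n] : ∀ (x : ℕ → ℚ) {N} → (∀ m → N ℕ.≤ m → x (suc (suc m)) ≤ x m) →
               ∀ {n} → N ℕ.≤ n → ∀ k → x (k ℕ.* 2 ℕ.+ n) ≤ x n
x[2k+n]≤x[n] x step N≤n zero    = ≤-refl
x[2k+n]≤x[n] x step {n} N≤n (suc k) =
  ≤-trans (step (k ℕ.* 2 ℕ.+ n) (ℕP.≤-trans N≤n (ℕP.m≤n+m n (k ℕ.* 2)))) (x[2k+n]≤x[n] x step N≤n k)

-- If x_n ≤ 0 then every x_{n+2+2k} stays below x_{n+2} < 0, so x cannot tend to 0.
convergesTo0∧x[2+m]<x[m]⇒0<x : ∀ (x : ℕ → ℚ) N → ConvergesTo x 0ℚ →
                                 (∀ m → N ℕ.≤ m → x (suc (suc m)) < x m) →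
                                 ∀ n → N ℕ.≤ n → 0ℚ < x n
convergesTo0∧x[2+m]<x[m]⇒0<x x N x→0 step n N≤n with x n ≤? 0ℚ
... | no  xₙ≰0 = ≰⇒> xₙ≰0
... | yes xₙ≤0 = ⊥-elim (<-irrefl refl (≤-<-trans -ν≤∣xₘ∣ ∣xₘ∣<-ν))
  where
    ν : ℚ
    ν = x (suc (suc n))
    0<-ν : 0ℚ < - ν
    0<-ν = neg-antimono-< (<-≤-trans (step n N≤n) xₙ≤0)
    M : ℕ
    M = proj₁ (x→0 (- ν) 0<-ν)
    m : ℕ
    m = M ℕ.* 2 ℕ.+ suc (suc n)
    ∣xₘ∣<-ν : ∣ x m - 0ℚ ∣ < - ν
    ∣xₘ∣<-ν = proj₂ (x→0 (- ν) 0<-ν) m (ℕP.≤-trans (ℕP.m≤m*n M 2) (ℕP.m≤m+n (M ℕ.* 2) _))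
    xₘ≤ν : x m ≤ ν
    xₘ≤ν = x[2k+n]≤x[n] x (λ k N≤k → <⇒≤ (step k N≤k)) (ℕP.m≤n⇒m≤1+n (ℕP.m≤n⇒m≤1+n N≤n)) M
    -ν≤∣xₘ∣ : - ν ≤ ∣ x m - 0ℚ ∣
    -ν≤∣xₘ∣ = ≤-trans (neg-antimono-≤ xₘ≤ν)
                (subst (λ y → - x m ≤ ∣ y ∣) (sym (+-identityʳ (x m))) (-p≤∣p∣ (x m)))

k+f[k]≤f[0] : ∀ {f} → InfiniteDescendingSequence ℕ._<_ f → ∀ k → k ℕ.+ f k ℕ.≤ f 0
k+f[k]≤f[0] desc zero    = ℕP.≤-refl
k+f[k]≤f[0] {f} desc (suc k) =
  ℕP.≤-trans (subst (ℕ._≤ k ℕ.+ f k) (ℕP.+-suc k (f (suc k))) (ℕP.+-monoʳ-≤ k (desc k)))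
             (k+f[k]≤f[0] desc k)

no-infinite-descent : ∀ f → ¬ InfiniteDescendingSequence ℕ._<_ f
no-infinite-descent f desc = ℕP.<-irrefl refl (ℕP.m+n≤o⇒m≤o (suc (f 0)) (k+f[k]≤f[0] desc (suc (f 0))))

0≤i<j⇒∣i∣<∣j∣ : ∀ {i j} → + 0 ℤ.≤ i → i ℤ.< j → ℤ.∣ i ∣ ℕ.< ℤ.∣ j ∣
0≤i<j⇒∣i∣<∣j∣ (ℤ.+≤+ _) (ℤ.+<+ m<n) = m<n

-- Remainders of the alternating series

minusOnePow : ℕ → ℚ
minusOnePow = negPow 1

minusOnePow-suc : ∀ n → minusOnePow (suc n) ≡ - minusOnePow n
minusOnePow-suc n = trans (sym (neg-distribˡ-* 1ℚ (minusOnePow n))) (cong -_ (*-identityˡ (minusOnePow n)))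

minusOnePow*minusOnePow≡1 : ∀ n → minusOnePow n * minusOnePow n ≡ 1ℚ
minusOnePow*minusOnePow≡1 zero = refl
minusOnePow*minusOnePow≡1 (suc n) = begin
  minusOnePow (suc n) * minusOnePow (suc n) ≡⟨ cong₂ _*_ (minusOnePow-suc n) (minusOnePow-suc n) ⟩
  (- minusOnePow n) * (- minusOnePow n)     ≡⟨ solve 1 (λ s → (:- s) :* (:- s) := s :* s) refl (minusOnePow n) ⟩
  minusOnePow n * minusOnePow n             ≡⟨ minusOnePow*minusOnePow≡1 n ⟩
  1ℚ                                        ∎
  where open ≡-Reasoning
        open ℚSolver.+-*-Solver

∣minusOnePow∣≡1 : ∀ n → ∣ minusOnePow n ∣ ≡ 1ℚ
∣minusOnePow∣≡1 zero = refl
∣minusOnePow∣≡1 (suc n) =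
  trans (cong ∣_∣ (minusOnePow-suc n)) (trans (∣-p∣≡∣p∣ (minusOnePow n)) (∣minusOnePow∣≡1 n))

negPow≡minusOnePow*^ : ∀ l n → negPow l n ≡ minusOnePow n * fromℕ (l ℕ.^ n)
negPow≡minusOnePow*^ l zero = refl
negPow≡minusOnePow*^ l (suc n) = begin
  (- fromℕ l) * negPow l n
    ≡⟨ cong ((- fromℕ l) *_) (negPow≡minusOnePow*^ l n) ⟩
  (- fromℕ l) * (minusOnePow n * fromℕ (l ℕ.^ n))
    ≡⟨ solve 3 (λ a s b → (:- a) :* (s :* b) := (:- s) :* (a :* b)) refl (fromℕ l) (minusOnePow n) (fromℕ (l ℕ.^ n)) ⟩
  (- minusOnePow n) * (fromℕ l * fromℕ (l ℕ.^ n))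
    ≡⟨ cong₂ _*_ (sym (minusOnePow-suc n)) (sym (fromℕ-homo-* l (l ℕ.^ n))) ⟩
  minusOnePow (suc n) * fromℕ (l ℕ.^ suc n) ∎
  where open ≡-Reasoning
        open ℚSolver.+-*-Solver

module Remainder (p : ℕ → ℕ) (l : ℕ) (q : ℚ) where

  absTerm : ℕ → ℚ
  absTerm n = fromℕ (l ℕ.^ n) * inv (p n)

  remainder : ℕ → ℚ
  remainder n = minusOnePow (suc n) * (q - partialSum p l n)

  remainder-suc : ∀ n → remainder (suc n) ≡ absTerm (suc n) - remainder n
  remainder-suc n = begin
    minusOnePow (suc (suc n)) * (q - (S + negPow l (suc n) * i))
      ≡⟨ cong₂ (λ a b → a * (q - (S + b * i))) (minusOnePow-suc (suc n)) (negPow≡minusOnePow*^ l (suc n)) ⟩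
    (- s) * (q - (S + (s * L) * i))
      ≡⟨ solve 5 (λ s L i Q S → (:- s) :* (Q :- (S :+ (s :* L) :* i)) := (s :* s) :* (L :* i) :- s :* (Q :- S)) refl s L i q S ⟩
    (s * s) * (L * i) - s * (q - S)
      ≡⟨ cong (λ z → z * (L * i) - s * (q - S)) (minusOnePow*minusOnePow≡1 (suc n)) ⟩
    1ℚ * (L * i) - s * (q - S)
      ≡⟨ cong (_- s * (q - S)) (*-identityˡ (L * i)) ⟩
    absTerm (suc n) - remainder n ∎
    where
      open ≡-Reasoning
      open ℚSolver.+-*-Solver
      S = partialSum p l n
      s = minusOnePow (suc n)
      L = fromℕ (l ℕ.^ suc n)
      i = inv (p (suc n))

  remainder+remainder-suc : ∀ n → remainder n + remainder (suc n) ≡ absTerm (suc n)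
  remainder+remainder-suc n = trans (cong (λ z → remainder n + z) (remainder-suc n))
    (solve 2 (λ r s → r :+ (s :- r) := s) refl (remainder n) (absTerm (suc n)))
    where open ℚSolver.+-*-Solver

  remainder-suc-suc : ∀ n → remainder (suc (suc n)) ≡ remainder n + (absTerm (suc (suc n)) - absTerm (suc n))
  remainder-suc-suc n = trans (remainder-suc (suc n))
    (trans (cong (λ z → absTerm (suc (suc n)) - z) (remainder-suc n))
      (solve 3 (λ a b r → a :- (b :- r) := r :+ (a :- b)) refl (absTerm (suc (suc n))) (absTerm (suc n)) (remainder n)))
    where open ℚSolver.+-*-Solver

  ∣remainder∣ : ∀ n → ∣ remainder n - 0ℚ ∣ ≡ ∣ partialSum p l n - q ∣
  ∣remainder∣ n = begin
    ∣ s * (q - S) - 0ℚ ∣   ≡⟨ cong ∣_∣ (+-identityʳ (s * (q - S))) ⟩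
    ∣ s * (q - S) ∣        ≡⟨ ∣p*q∣≡∣p∣*∣q∣ s (q - S) ⟩
    ∣ s ∣ * ∣ q - S ∣      ≡⟨ cong (_* ∣ q - S ∣) (∣minusOnePow∣≡1 (suc n)) ⟩
    1ℚ * ∣ q - S ∣         ≡⟨ *-identityˡ _ ⟩
    ∣ q - S ∣              ≡⟨ cong ∣_∣ (solve 2 (λ Q S → Q :- S := :- (S :- Q)) refl q S) ⟩
    ∣ - (S - q) ∣          ≡⟨ ∣-p∣≡∣p∣ (S - q) ⟩
    ∣ S - q ∣              ∎
    where
      open ≡-Reasoning
      open ℚSolver.+-*-Solver
      S = partialSum p l n
      s = minusOnePow (suc n)

  remainder→0 : ConvergesTo (partialSum p l) q → ConvergesTo remainder 0ℚ
  remainder→0 S→q ε 0<ε with S→q ε 0<ε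
  ... | M , close = M , λ m M≤m → subst (_< ε) (sym (∣remainder∣ m)) (close m M≤m)

-- The growth condition, cross-multiplied for comparing lᵏ⁺¹ / P′ with lᵏ / P.
growth⇒cross-≤ : ∀ l k {P P′} → l ℕ.* (P ℕ.* (P ℕ.+ 1)) ℕ.≤ P′ →
                 l ℕ.^ suc k ℕ.* P ℕ.* (P ℕ.+ 1) ℕ.≤ l ℕ.^ k ℕ.* P′
growth⇒cross-≤ l k {P} {P′} g = subst (ℕ._≤ l ℕ.^ k ℕ.* P′)
  (solve 3 (λ l L P → L :* (l :* (P :* (P :+ con 1))) := l :* L :* P :* (P :+ con 1)) refl l (l ℕ.^ k) P)
  (ℕP.*-monoʳ-≤ (l ℕ.^ k) g)
  where open ℕSolver.+-*-Solver

growth⇒cross-< : ∀ {l} k {P P′} → 1 ℕ.≤ l → 1 ℕ.≤ P → l ℕ.* (P ℕ.* (P ℕ.+ 1)) ℕ.≤ P′ →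
                 l ℕ.^ suc k ℕ.* P ℕ.< l ℕ.^ k ℕ.* P′
growth⇒cross-< {l} k {P} l≥1 P≥1 g = ℕP.<-≤-trans
  (ℕP.m<m*n (l ℕ.^ suc k ℕ.* P) (P ℕ.+ 1)
    {{ℕ.>-nonZero (ℕP.*-mono-≤ (ℕP.m^n>0 l {{ℕ.>-nonZero l≥1}} (suc k)) P≥1)}}
    (ℕP.+-monoˡ-≤ 1 P≥1))
  (growth⇒cross-≤ l k g)

module Irrationality (p : ℕ → ℕ) (l : ℕ) (q : ℚ) (N : ℕ)
  (l≥1 : 1 ℕ.≤ l) (p≥1 : ∀ n → 1 ℕ.≤ n → 1 ℕ.≤ p n)
  (growth : ∀ n → N ℕ.≤ n → l ℕ.* (p n ℕ.* (p n ℕ.+ 1)) ℕ.≤ p (suc n))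
  (S→q : ConvergesTo (partialSum p l) q) where
  open Remainder p l q

  absTerm-step-< : ∀ n → N ℕ.≤ suc n → absTerm (suc (suc n)) < absTerm (suc n)
  absTerm-step-< n N≤1+n
    with p (suc n) | p≥1 (suc n) (ℕ.s≤s ℕ.z≤n) | p (suc (suc n)) | p≥1 (suc (suc n)) (ℕ.s≤s ℕ.z≤n)
       | growth (suc n) N≤1+n
  ... | suc y | P≥1 | suc v | _ | g =
    fromℕ*inv-< (l ℕ.^ suc (suc n)) v (l ℕ.^ suc n) y (growth⇒cross-< (suc n) l≥1 P≥1 g)

  absTerm-step-≤ : ∀ n → N ℕ.≤ suc n → (fromℕ (p (suc n)) + 1ℚ) * absTerm (suc (suc n)) ≤ absTerm (suc n)
  absTerm-step-≤ n N≤1+n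
    with p (suc n) | p≥1 (suc n) (ℕ.s≤s ℕ.z≤n) | p (suc (suc n)) | p≥1 (suc (suc n)) (ℕ.s≤s ℕ.z≤n)
       | growth (suc n) N≤1+n
  ... | suc y | _ | suc v | _ | g = begin
    (fromℕ (suc y) + 1ℚ) * (L′ * inv (suc v))                 ≡⟨ *-assoc (fromℕ (suc y) + 1ℚ) L′ (inv (suc v)) ⟨
    (fromℕ (suc y) + 1ℚ) * L′ * inv (suc v)                   ≡⟨ cong (_* inv (suc v)) [P+1]L′≡ ⟨
    fromℕ (l ℕ.^ suc (suc n) ℕ.* (suc y ℕ.+ 1)) * inv (suc v) ≤⟨ fromℕ*inv-≤ (l ℕ.^ suc (suc n) ℕ.* (suc y ℕ.+ 1)) v
                                                                       (l ℕ.^ suc n) y cross ⟩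
    fromℕ (l ℕ.^ suc n) * inv (suc y)                         ∎
    where
      open ≤-Reasoning
      open ℕSolver.+-*-Solver
      L′ = fromℕ (l ℕ.^ suc (suc n))
      [P+1]L′≡ : fromℕ (l ℕ.^ suc (suc n) ℕ.* (suc y ℕ.+ 1)) ≡ (fromℕ (suc y) + 1ℚ) * L′
      [P+1]L′≡ = trans (fromℕ-homo-* (l ℕ.^ suc (suc n)) (suc y ℕ.+ 1))
                   (trans (*-comm L′ _) (cong (_* L′) (fromℕ-homo-+ (suc y) 1)))
      cross : l ℕ.^ suc (suc n) ℕ.* (suc y ℕ.+ 1) ℕ.* suc y ℕ.≤ l ℕ.^ suc n ℕ.* suc v
      cross = subst (ℕ._≤ l ℕ.^ suc n ℕ.* suc v)
        (solve 2 (λ L P → L :* P :* (P :+ con 1) := L :* (P :+ con 1) :* P) refl (l ℕ.^ suc (suc n)) (suc y))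
        (growth⇒cross-≤ l (suc n) g)

  remainder-pos : ∀ n → N ℕ.≤ n → 0ℚ < remainder n
  remainder-pos = convergesTo0∧x[2+m]<x[m]⇒0<x remainder N (remainder→0 S→q) λ m N≤m →
    subst (_< remainder m) (sym (remainder-suc-suc m))
      (x+[y-z]<x (remainder m) (absTerm-step-< m (ℕP.m≤n⇒m≤1+n N≤m)))

  p*remainder-suc<remainder : ∀ n → N ℕ.≤ n → fromℕ (p (suc n)) * remainder (suc n) < remainder n
  p*remainder-suc<remainder n N≤n = summand-scaled-< (fromℕ-nonNeg (p (suc n)))
    (remainder+remainder-suc n)
    (subst (remainder (suc n) <_) (remainder+remainder-suc (suc n))
      (x<x+y (remainder (suc n)) (remainder-pos (suc (suc n)) (ℕP.m≤n⇒m≤1+n (ℕP.m≤n⇒m≤1+n N≤n)))))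
    (absTerm-step-≤ n (ℕP.m≤n⇒m≤1+n N≤n))

  commonDenominator : ℕ → ℕ
  commonDenominator zero    = ↧ₙ q
  commonDenominator (suc n) = commonDenominator n ℕ.* p (suc n)

  0<commonDenominator : ∀ n → 0ℚ < fromℕ (commonDenominator n)
  0<commonDenominator n = fromℤ-mono-< {+ 0} (ℤ.+<+ (D≥1 n))
    where
      D≥1 : ∀ n → 1 ℕ.≤ commonDenominator n
      D≥1 zero    = ℕ.s≤s ℕ.z≤n
      D≥1 (suc n) = ℕP.*-mono-≤ (D≥1 n) (p≥1 (suc n) (ℕ.s≤s ℕ.z≤n))

  -- commonDenominator n * remainder n, defined through the recurrence of remainder so that it is
  -- visibly an integer.
  clearedRemainder : ℕ → ℤ
  clearedRemainder zero    = ℤ.- ↥ q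
  clearedRemainder (suc n) =
    + (commonDenominator n ℕ.* l ℕ.^ suc n) ℤ.- + p (suc n) ℤ.* clearedRemainder n

  fromℤ-clearedRemainder : ∀ n → fromℤ (clearedRemainder n) ≡ fromℕ (commonDenominator n) * remainder n
  fromℤ-clearedRemainder zero = begin
    fromℤ (ℤ.- ↥ q)              ≡⟨ fromℤ-homo-neg (↥ q) ⟩
    - fromℤ (↥ q)                ≡⟨ cong -_ (fromℤ-↥ q) ⟩
    - (B * q)                    ≡⟨ solve 2 (λ B Q → :- (B :* Q) := B :* ((:- con 1ℚ) :* (Q :- con 0ℚ))) refl B q ⟩
    B * ((- 1ℚ) * (q - 0ℚ))      ∎
    where
      open ≡-Reasoning
      open ℚSolver.+-*-Solver
      B = fromℕ (↧ₙ q)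
  fromℤ-clearedRemainder (suc n) = begin
    fromℤ (+ X ℤ.- + P ℤ.* a)
      ≡⟨ fromℤ-homo-+ (+ X) (ℤ.- (+ P ℤ.* a)) ⟩
    fromℕ X + fromℤ (ℤ.- (+ P ℤ.* a))
      ≡⟨ cong (λ z → fromℕ X + z) (trans (fromℤ-homo-neg (+ P ℤ.* a)) (cong -_ (fromℤ-homo-* (+ P) a))) ⟩
    fromℕ X - fromℕ P * fromℤ a
      ≡⟨ cong₂ (λ u v → u - fromℕ P * v) (fromℕ-homo-* D (l ℕ.^ suc n)) (fromℤ-clearedRemainder n) ⟩
    fromℕ D * L - fromℕ P * (fromℕ D * remainder n)
      ≡⟨ cong (λ z → z - fromℕ P * (fromℕ D * remainder n))
           (sym (trans (cong (fromℕ D * L *_) (fromℕ*inv≡1 (p≥1 (suc n) (ℕ.s≤s ℕ.z≤n))))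
                       (*-identityʳ (fromℕ D * L)))) ⟩
    fromℕ D * L * (fromℕ P * inv P) - fromℕ P * (fromℕ D * remainder n)
      ≡⟨ solve 5 (λ D L P i r → D :* L :* (P :* i) :- P :* (D :* r) := (D :* P) :* (L :* i :- r))
           refl (fromℕ D) L (fromℕ P) (inv P) (remainder n) ⟩
    (fromℕ D * fromℕ P) * (absTerm (suc n) - remainder n)
      ≡⟨ cong₂ _*_ (sym (fromℕ-homo-* D P)) (sym (remainder-suc n)) ⟩
    fromℕ (D ℕ.* P) * remainder (suc n) ∎
    where
      open ≡-Reasoning
      open ℚSolver.+-*-Solver
      D = commonDenominator n
      P = p (suc n)
      X = D ℕ.* l ℕ.^ suc n
      L = fromℕ (l ℕ.^ suc n)
      a = clearedRemainder n

  clearedRemainder-pos : ∀ n → N ℕ.≤ n → + 0 ℤ.< clearedRemainder n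
  clearedRemainder-pos n N≤n = fromℤ-cancel-< {+ 0} (subst (0ℚ <_) (sym (fromℤ-clearedRemainder n))
    (positive⁻¹ (D * r)
      {{pos*pos⇒pos D {{positive (0<commonDenominator n)}} r {{positive (remainder-pos n N≤n)}}}}))
    where
      D = fromℕ (commonDenominator n)
      r = remainder n

  clearedRemainder-suc-< : ∀ n → N ℕ.≤ n → clearedRemainder (suc n) ℤ.< clearedRemainder n
  clearedRemainder-suc-< n N≤n = fromℤ-cancel-< (begin-strict
    fromℤ (clearedRemainder (suc n))                 ≡⟨ fromℤ-clearedRemainder (suc n) ⟩
    fromℕ (D ℕ.* P) * remainder (suc n)              ≡⟨ cong (_* remainder (suc n)) (fromℕ-homo-* D P) ⟩
    fromℕ D * fromℕ P * remainder (suc n)            ≡⟨ *-assoc (fromℕ D) (fromℕ P) (remainder (suc n)) ⟩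
    fromℕ D * (fromℕ P * remainder (suc n))          <⟨ *-monoʳ-<-pos (fromℕ D) {{positive (0<commonDenominator n)}}
                                                          (p*remainder-suc<remainder n N≤n) ⟩
    fromℕ D * remainder n                            ≡⟨ fromℤ-clearedRemainder n ⟨
    fromℤ (clearedRemainder n)                       ∎)
    where
      open ≤-Reasoning
      D = commonDenominator n
      P = p (suc n)

  absurd : ⊥
  absurd = no-infinite-descent (λ k → ℤ.∣ clearedRemainder (k ℕ.+ N) ∣) λ k →
    0≤i<j⇒∣i∣<∣j∣ (ℤP.<⇒≤ (clearedRemainder-pos (suc (k ℕ.+ N)) (ℕP.m≤n⇒m≤1+n (ℕP.m≤n+m N k))))
                  (clearedRemainder-suc-< (k ℕ.+ N) (ℕP.m≤n+m N k))

theorem4p1 : (K : ℚ) → (+ 1) / 1 ≤ K →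
    (p : ℕ → ℕ) → (∀ n → 1 ℕ.≤ n → 1 ℕ.≤ p n) →
    (∃[ N ] ∀ n → N ℕ.≤ n → K * ((+ (p n ℕ.* (p n ℕ.+ 1))) / 1) ≤ (+ p (suc n)) / 1) →
    (l : ℕ) → 1 ℕ.≤ l → + l ℤ.≤ floor K →
    ∀ (q : ℚ) → ¬ ConvergesTo (partialSum p l) q
theorem4p1 K _ p p≥1 (N , K-growth) l l≥1 l≤⌊K⌋ q S→q =
  Irrationality.absurd p l q N l≥1 p≥1 growth S→q
  where
    growth : ∀ n → N ℕ.≤ n → l ℕ.* (p n ℕ.* (p n ℕ.+ 1)) ℕ.≤ p (suc n)
    growth n N≤n = ≤floor∧K*m≤n⇒l*m≤n K (p n ℕ.* (p n ℕ.+ 1)) (p (suc n)) l≤⌊K⌋ (K-growth n N≤n)
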